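{- Work intuitionistically. Let $X$ be an overt locale and define $R_X:\Omega X\to\Omega X$ by $$R_X(y)=\bigvee\{x\in\Omega X\mid \forall z\in\Omega X\ (\mathrm{Pos}_X(z\wedge x)\le\mathrm{Pos}_X(z\wedge y))\}.$$ Then $R_X$ is a nucleus on $\Omega X$, and the sublocale $X_{R_X}$ it determines is the smallest overt, strongly dense sublocale of $X$.
   Context: A locale $X$ is given by its frame $\Omega X$. $\Omega$ is the frame of truth values (power set of a singleton); $\Omega!_X:\Omega\to\Omega X$ is $\Omega!_X(p)=\bigvee\{x\in\Omega X\mid x=1\text{ and }p=1\}$. $X$ is overt if $\Omega!_X$ has a left adjoint $\mathrm{Pos}_X:\Omega X\to\Omega$. A nucleus on $\Omega X$ is a map $j$ with $x\le j(x)=j(j(x))$, monotone, and preserving binary meets; it determines the sublocale $X_j$ with frame $\mathrm{Fix}(j)$ (meets as in $\Omega X$, joins the $j$-closures of joins in $\Omega X$). $X_{j_1}$ is contained in $X_{j_2}$ iff $\mathrm{Fix}(j_1)\subseteq\mathrm{Fix}(j_2)$. A sublocale $X_j$ is strongly dense if $j\circ\Omega!_X=\Omega!_X$. The locale $X_j$ is overt if $\Omega!_{X_j}=j\circ\Omega!_X$ has a left adjoint. -}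

module Defs where

open import Level using (Level; _⊔_; suc)
open import Data.Product using (Σ; _×_; _,_)
open import Function.Bundles using (_⇔_)
open import Relation.Binary.Structures using (IsPartialOrder)

-- Truth values
-- (elements of Ω) are propositions P : Set (c ⊔ ℓ), ordered by implication.
record Frame (c ℓ : Level) : Set (suc (c ⊔ ℓ)) where
  infix  4 _≈_ _≤_
  infixr 7 _∧_
  field
    Carrier        : Set c
    _≈_            : Carrier → Carrier → Set ℓ
    _≤_            : Carrier → Carrier → Set ℓ
    isPartialOrder : IsPartialOrder _≈_ _≤_
    ⊤              : Carrier
    ⊤-max          : ∀ x → x ≤ ⊤
    _∧_            : Carrier → Carrier → Carrier
    ∧-lb₁          : ∀ x y → x ∧ y ≤ x
    ∧-lb₂          : ∀ x y → x ∧ y ≤ y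
    ∧-glb          : ∀ x y z → z ≤ x → z ≤ y → z ≤ x ∧ y
    ⋁              : (Carrier → Set (c ⊔ ℓ)) → Carrier
    ⋁-ub           : ∀ (S : Carrier → Set (c ⊔ ℓ)) x → S x → x ≤ ⋁ S
    ⋁-lub          : ∀ (S : Carrier → Set (c ⊔ ℓ)) u → (∀ x → S x → x ≤ u) → ⋁ S ≤ u
    distrib        : ∀ x (S : Carrier → Set (c ⊔ ℓ)) →
                     x ∧ ⋁ S ≤ ⋁ (λ y → Σ Carrier (λ s → S s × (y ≈ x ∧ s)))

module _ {c ℓ : Level} (X : Frame c ℓ) where
  open Frame X

  Ω : Set (suc (c ⊔ ℓ))
  Ω = Set (c ⊔ ℓ)

  Ω! : Ω → Carrier
  Ω! p = ⋁ (λ x → (x ≈ ⊤) × p)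

  IsPos : (Carrier → Ω) → Set (suc (c ⊔ ℓ))
  IsPos Pos = ∀ (x : Carrier) (p : Ω) → ((Pos x → p) ⇔ (x ≤ Ω! p))

  Overt : Set (suc (c ⊔ ℓ))
  Overt = Σ (Carrier → Ω) IsPos

  record IsNucleus (j : Carrier → Carrier) : Set (c ⊔ ℓ) where
    field
      inflationary : ∀ x → x ≤ j x
      idempotent   : ∀ x → j (j x) ≈ j x
      monotone     : ∀ x y → x ≤ y → j x ≤ j y
      preserves-∧  : ∀ x y → j (x ∧ y) ≈ j x ∧ j y

  -- Fix(j), the frame of the sublocale X_j
  Fix : (Carrier → Carrier) → Carrier → Set ℓ
  Fix j x = j x ≈ x

  -- X_{j₁} ⊆ X_{j₂}  iff  Fix(j₁) ⊆ Fix(j₂)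
  _⊆ₛ_ : (Carrier → Carrier) → (Carrier → Carrier) → Set (c ⊔ ℓ)
  j₁ ⊆ₛ j₂ = ∀ x → Fix j₁ x → Fix j₂ x

  StronglyDense : (Carrier → Carrier) → Set (suc (c ⊔ ℓ))
  StronglyDense j = ∀ (p : Ω) → j (Ω! p) ≈ Ω! p

  -- X_j overt: Ω!_{X_j} = j ∘ Ω!_X : Ω → Fix(j) has a left adjoint
  -- Fix(j) → Ω (order on Fix(j) is that of ΩX).
  OvertSub : (Carrier → Carrier) → Set (suc (c ⊔ ℓ))
  OvertSub j = Σ (Carrier → Ω) λ Pos′ →
    ∀ (x : Carrier) → Fix j x → ∀ (p : Ω) → ((Pos′ x → p) ⇔ (x ≤ j (Ω! p)))

  R : (Carrier → Ω) → Carrier → Carrier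
  R Pos y = ⋁ (λ x → ∀ (z : Carrier) → Pos (z ∧ x) → Pos (z ∧ y))

module Submission where

open import Level using (Level; _⊔_)
open import Data.Product using (Σ; _×_; _,_)
open import Function.Base using (id; _∘_)
open import Function.Bundles using (mk⇔; Equivalence)
open import Relation.Binary.Lattice.Bundles using (MeetSemilattice)
import Relation.Binary.Lattice.Properties.MeetSemilattice as MeetSemilatticeProperties
import Relation.Binary.Reasoning.PartialOrder as ≤-Reasoning
open import Defs

-- x ⊑ y, "every z meeting x positively meets y positively", is a preorder
-- containing ≤ and stable under meets.  Because Pos is a left adjoint it
-- preserves joins, so together with distributivity R y is the largest x
-- with x ⊑ y; the nucleus laws follow from this universal property.
-- For a nucleus j, z ∧ j x ≤ j (z ∧ x), and j (Ω! p) = Ω! p says that j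
-- does not change positivity; hence j x ⊑ x, i.e. j x ≤ R x, for every
-- strongly dense j, which gives minimality.  Strong density alone makes
-- X_j overt (with the positivity predicate of X), so R is overt.

module FrameProperties {c ℓ : Level} (X : Frame c ℓ) where
  open Frame X

  meetSemilattice : MeetSemilattice c ℓ ℓ
  meetSemilattice = record
    { isMeetSemilattice = record
      { isPartialOrder = isPartialOrder
      ; infimum        = λ x y → ∧-lb₁ x y , ∧-lb₂ x y , ∧-glb x y
      }
    }

  open MeetSemilattice meetSemilattice public
    using (poset; antisym; refl; trans; reflexive) renaming (module Eq to ≈)
  open MeetSemilatticeProperties meetSemilattice public
    using (∧-monotonic; ∧-comm; ∧-assoc)

  Ω!-mono : ∀ {p q : Ω X} → (p → q) → Ω! X p ≤ Ω! X q
  Ω!-mono p⇒q = ⋁-lub _ _ λ { x (x≈⊤ , p) → ⋁-ub _ x (x≈⊤ , p⇒q p) }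

  x∧jy≤j[x∧y] : ∀ {j} → IsNucleus X j → ∀ x y → x ∧ j y ≤ j (x ∧ y)
  x∧jy≤j[x∧y] {j} isNucleus x y = begin
    x ∧ j y    ≤⟨ ∧-monotonic (inflationary x) refl ⟩
    j x ∧ j y  ≈⟨ ≈.sym (preserves-∧ x y) ⟩
    j (x ∧ y)  ∎
    where open IsNucleus isNucleus
          open ≤-Reasoning poset

module OvertProperties {c ℓ : Level} (X : Frame c ℓ)
                       (Pos : Frame.Carrier X → Ω X) (isPos : IsPos X Pos) where
  open Frame X
  open FrameProperties X
  open ≤-Reasoning poset

  Pos⇒≤ : ∀ {x} {p : Ω X} → (Pos x → p) → x ≤ Ω! X p
  Pos⇒≤ = Equivalence.to (isPos _ _)

  ≤⇒Pos : ∀ {x} {p : Ω X} → x ≤ Ω! X p → Pos x → p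
  ≤⇒Pos = Equivalence.from (isPos _ _)

  ≤-Ω!-Pos : ∀ x → x ≤ Ω! X (Pos x)
  ≤-Ω!-Pos x = Pos⇒≤ id

  Pos-mono : ∀ {x y} → x ≤ y → Pos x → Pos y
  Pos-mono {y = y} x≤y = ≤⇒Pos (trans x≤y (≤-Ω!-Pos y))

  Pos-Ω! : ∀ {p : Ω X} → Pos (Ω! X p) → p
  Pos-Ω! = ≤⇒Pos refl

  Pos-⋁ : ∀ S → Pos (⋁ S) → Σ Carrier λ s → S s × Pos s
  Pos-⋁ S = ≤⇒Pos (⋁-lub S _ λ s s∈S → trans (≤-Ω!-Pos s) (Ω!-mono (λ pos → s , s∈S , pos)))

  infix 4 _⊑_
  _⊑_ : Carrier → Carrier → Set (c ⊔ ℓ)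
  x ⊑ y = ∀ z → Pos (z ∧ x) → Pos (z ∧ y)

  ⊑-trans : ∀ {x y w} → x ⊑ y → y ⊑ w → x ⊑ w
  ⊑-trans x⊑y y⊑w z = y⊑w z ∘ x⊑y z

  ≤⇒⊑ : ∀ {x y} → x ≤ y → x ⊑ y
  ≤⇒⊑ x≤y z = Pos-mono (∧-monotonic refl x≤y)

  ⊑⇒Pos : ∀ {x y} → x ⊑ y → Pos x → Pos y
  ⊑⇒Pos {x} {y} x⊑y = Pos-mono (∧-lb₂ ⊤ y) ∘ x⊑y ⊤ ∘ Pos-mono (∧-glb ⊤ x x (⊤-max x) refl)

  ∧-monoʳ-⊑ : ∀ w {x y} → x ⊑ y → w ∧ x ⊑ w ∧ y
  ∧-monoʳ-⊑ w {x} {y} x⊑y z =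
    Pos-mono (reflexive (∧-assoc z w y)) ∘ x⊑y (z ∧ w) ∘ Pos-mono (reflexive (≈.sym (∧-assoc z w x)))

  ∧-monoˡ-⊑ : ∀ w {x y} → x ⊑ y → x ∧ w ⊑ y ∧ w
  ∧-monoˡ-⊑ w {x} {y} x⊑y =
    ⊑-trans (≤⇒⊑ (reflexive (∧-comm x w))) (⊑-trans (∧-monoʳ-⊑ w x⊑y) (≤⇒⊑ (reflexive (∧-comm w y))))

  ∧-mono-⊑ : ∀ {x y u v} → x ⊑ y → u ⊑ v → x ∧ u ⊑ y ∧ v
  ∧-mono-⊑ {y = y} {u} x⊑y u⊑v = ⊑-trans (∧-monoˡ-⊑ u x⊑y) (∧-monoʳ-⊑ y u⊑v)

  R-⊑ : ∀ y → R X Pos y ⊑ y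
  R-⊑ y z pos with Pos-⋁ _ (Pos-mono (distrib z _) pos)
  ... | w , (x , x⊑y , w≈z∧x) , pos-w = x⊑y z (Pos-mono (reflexive w≈z∧x) pos-w)

  ⊑⇒≤R : ∀ {x y} → x ⊑ y → x ≤ R X Pos y
  ⊑⇒≤R {x} = ⋁-ub _ x

  R-inflationary : ∀ x → x ≤ R X Pos x
  R-inflationary x = ⊑⇒≤R (λ _ → id)

  R-mono : ∀ {x y} → x ≤ y → R X Pos x ≤ R X Pos y
  R-mono x≤y = ⊑⇒≤R (⊑-trans (R-⊑ _) (≤⇒⊑ x≤y))

  R-isNucleus : IsNucleus X (R X Pos)
  R-isNucleus = record
    { inflationary = R-inflationary
    ; idempotent   = λ x → antisym (⊑⇒≤R (⊑-trans (R-⊑ (R X Pos x)) (R-⊑ x)))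
                                   (R-inflationary (R X Pos x))
    ; monotone     = λ _ _ → R-mono
    ; preserves-∧  = λ x y → antisym
        (∧-glb _ _ _ (R-mono (∧-lb₁ x y)) (R-mono (∧-lb₂ x y)))
        (⊑⇒≤R (∧-mono-⊑ (R-⊑ x) (R-⊑ y)))
    }

  R-stronglyDense : StronglyDense X (R X Pos)
  R-stronglyDense p = antisym (Pos⇒≤ (Pos-Ω! ∘ ⊑⇒Pos (R-⊑ (Ω! X p))))
                              (R-inflationary (Ω! X p))

  stronglyDense⇒overtSub : ∀ {j} → StronglyDense X j → OvertSub X j
  stronglyDense⇒overtSub dense = Pos , λ x _ p → mk⇔
    (λ pos⇒p → trans (Pos⇒≤ pos⇒p) (reflexive (≈.sym (dense p))))
    (λ x≤jΩ!p → ≤⇒Pos (trans x≤jΩ!p (reflexive (dense p))))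

  stronglyDense-⊑ : ∀ {j} → IsNucleus X j → StronglyDense X j → ∀ x → j x ⊑ x
  stronglyDense-⊑ {j} isNucleus dense x z = ≤⇒Pos (begin
    z ∧ j x                    ≤⟨ x∧jy≤j[x∧y] isNucleus z x ⟩
    j (z ∧ x)                  ≤⟨ monotone _ _ (≤-Ω!-Pos (z ∧ x)) ⟩
    j (Ω! X (Pos (z ∧ x)))     ≈⟨ dense (Pos (z ∧ x)) ⟩
    Ω! X (Pos (z ∧ x))         ∎)
    where open IsNucleus isNucleus

  R-⊆ₛ-stronglyDense : ∀ {j} → IsNucleus X j → StronglyDense X j → _⊆ₛ_ X (R X Pos) j
  R-⊆ₛ-stronglyDense isNucleus dense x Rx≈x = antisym
    (trans (⊑⇒≤R (stronglyDense-⊑ isNucleus dense x)) (reflexive Rx≈x))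
    (IsNucleus.inflationary isNucleus x)

proposition3p5 : {c ℓ : Level} (X : Frame c ℓ) (Pos : Frame.Carrier X → Ω X) →
    IsPos X Pos →
    IsNucleus X (R X Pos)
    × OvertSub X (R X Pos)
    × StronglyDense X (R X Pos)
    × ((j : Frame.Carrier X → Frame.Carrier X) → IsNucleus X j →
        OvertSub X j → StronglyDense X j → _⊆ₛ_ X (R X Pos) j)
proposition3p5 X Pos isPos =
  R-isNucleus ,
  stronglyDense⇒overtSub R-stronglyDense ,
  R-stronglyDense ,
  λ j isNucleus _ dense → R-⊆ₛ-stronglyDense isNucleus dense
  where open OvertProperties X Pos isPos
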